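{- Let $G=(V,E)$ be an isoperimetric graph with optimal order $\mathcal O_G$ and isoperimetric partition $\mathfrak P_G=\{\mathcal O_G[a_1,b_1],\dots,\mathcal O_G[a_k,b_k]\}$. For $i\in\{1,\dots,k\}$ let $H_i=(\mathcal O_G[a_i,b_i],I_G(\mathcal O_G[a_i,b_i]))$ with the optimal order given by the restriction of $\mathcal O_G$. Then for all $x,y\in\mathcal O_G[a_i,b_i]$ with $y<_{\mathcal O_G}x$, $$\Delta_G(x)-\Delta_G(y)=\Delta_{H_i}(x)-\Delta_{H_i}(y).$$
   Context: For a finite simple graph $G=(V,E)$ and $A,B\subseteq V$, $I_G(A,B)$ is the set of edges with one end in $A$ and one in $B$, $I_G(A)=I_G(A,A)$, $I_G(m)=\max_{|S|=m}|I_G(S)|$. A total order is a bijection $\mathcal O:V\to\{1,\dots,|V|\}$, $\mathcal O[k,l]=\mathcal O^{ -1}(\{k,\dots,l\})$; it is optimal if $|I_G(\mathcal O[1,k])|=I_G(k)$ for all $k$; $G$ is isoperimetric if it has one. $\delta_G(1)=0$, $\delta_G(m)=I_G(m)-I_G(m-1)$ for $m\ge2$; for a fixed optimal order $\mathcal O_G$, $\Delta_G(v)=\delta_G(\mathcal O_G(v))$. An isoperimetric partition is a partition $\{\mathcal O_G[a_1,b_1],\dots,\mathcal O_G[a_k,b_k]\}$ of $V$ into consecutive intervals ($a_1=1$, $a_{i+1}=b_i+1$, $b_k=|V|$) such that each induced subgraph $(\mathcal O_G[a_i,b_i],I_G(\mathcal O_G[a_i,b_i]))$ is isoperimetric with the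 restriction of $\mathcal O_G$ as optimal order, and for every $v\in\mathcal O_G[a_i,b_i]$, $|I_G(\mathcal O_G[a_1,b_{i-1}],\{v\})|=\delta_G(a_i)$. -}

module Defs where

open import Data.Bool using (Bool; true; false; _∧_; _∨_; not; if_then_else_)
open import Data.Nat using (ℕ; zero; suc; _+_; _∸_; _≤_; _<_; _⊔_; _≡ᵇ_; _<ᵇ_; _≤ᵇ_)
open import Data.Fin using (Fin; toℕ; fromℕ; inject₁)
open import Data.Fin as Fin using ()
open import Data.Fin.Permutation using (Permutation′; _⟨$⟩ʳ_)
open import Data.Fin.Subset using (Subset; ⊤; ∣_∣)
open import Data.Vec using (Vec; []; _∷_; lookup; tabulate)
open import Data.List using (List; []; _∷_; map; _++_; foldr; allFin)
open import Data.Nat.ListAction using (sum)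
open import Data.Integer using (ℤ; +_; _-_)
open import Relation.Binary.PropositionalEquality using (_≡_)

record Graph (n : ℕ) : Set where
  field
    adj     : Fin n → Fin n → Bool
    adj-sym : ∀ u v → adj u v ≡ adj v u
    adj-irr : ∀ v → adj v v ≡ false
open Graph public

private
  bit : Bool → ℕ
  bit true  = 1
  bit false = 0

-- |I_G(A,B)| : number of edges with one end in A and the other in B
-- (each edge counted once: unordered pairs {u,v}, u ≠ v).
edgesBetween : ∀ {n} → Graph n → Subset n → Subset n → ℕ
edgesBetween {n} G A B =
  sum (map (λ u → sum (map (λ v →
      bit (adj G u v ∧ (toℕ u <ᵇ toℕ v)
           ∧ ((lookup A u ∧ lookup B v) ∨ (lookup A v ∧ lookup B u))))
    (allFin n))) (allFin n))

edgesIn : ∀ {n} → Graph n → Subset n → ℕ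
edgesIn G A = edgesBetween G A A

⁅_⁆ : ∀ {n} → Fin n → Subset n
⁅ v ⁆ = tabulate (λ u → toℕ u ≡ᵇ toℕ v)

allSubsets : ∀ n → List (Subset n)
allSubsets zero    = [] ∷ []
allSubsets (suc n) = map (true ∷_) (allSubsets n) ++ map (false ∷_) (allSubsets n)

_⊆ᵇ_ : ∀ {n} → Subset n → Subset n → Bool
[]      ⊆ᵇ []      = true
(s ∷ S) ⊆ᵇ (w ∷ W) = (not s ∨ w) ∧ (S ⊆ᵇ W)

-- I_H(m) for the induced subgraph H = (W, I_G(W)):
--   max { |I_G(S)| : S ⊆ W, |S| = m }   (0 if there is no such S).
-- Since H is induced, |I_H(S)| = |I_G(S)| for S ⊆ W.
Iind : ∀ {n} → Graph n → Subset n → ℕ → ℕ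
Iind {n} G W m =
  foldr _⊔_ 0 (map (λ S → if (∣ S ∣ ≡ᵇ m) ∧ (S ⊆ᵇ W) then edgesIn G S else 0)
                   (allSubsets n))

I : ∀ {n} → Graph n → ℕ → ℕ
I G m = Iind G ⊤ m

-- δ_H(m) for the induced subgraph on W (δ(1) = 0, δ(m) = I(m) - I(m-1));
-- δ(0) is never used and set to 0.
δind : ∀ {n} → Graph n → Subset n → ℕ → ℤ
δind G W zero          = + 0
δind G W (suc zero)    = + 0
δind G W (suc (suc m)) = + Iind G W (suc (suc m)) - + Iind G W (suc m)

δ : ∀ {n} → Graph n → ℕ → ℤ
δ G m = δind G ⊤ m

-- A total order O : V → {1..n} is represented by a permutation
-- O : Fin n → Fin n giving 0-based positions: the 1-based position of v
-- is toℕ (O ⟨$⟩ʳ v) + 1.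
pos : ∀ {n} → Permutation′ n → Fin n → ℕ
pos O v = toℕ (O ⟨$⟩ʳ v)

-- O[s+1, t] in 1-based notation, i.e. vertices with 0-based position in [s, t).
segment : ∀ {n} → Permutation′ n → ℕ → ℕ → Subset n
segment O s t = tabulate (λ v → (s ≤ᵇ pos O v) ∧ (pos O v <ᵇ t))

Optimal : ∀ {n} → Graph n → Permutation′ n → Set
Optimal {n} G O = ∀ k → k ≤ n → edgesIn G (segment O 0 k) ≡ I G k

OptimalOnBlock : ∀ {n} → Graph n → Permutation′ n → ℕ → ℕ → Set
OptimalOnBlock G O s t =
  ∀ j → j ≤ t ∸ s → edgesIn G (segment O s (s + j)) ≡ Iind G (segment O s t) j

-- Δ_G(v) = δ_G(O_G(v))   (1-based position)
Δ : ∀ {n} → Graph n → Permutation′ n → Fin n → ℤ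
Δ G O v = δ G (suc (pos O v))

-- Δ_H(v) for H the induced subgraph on the block with 0-based positions
-- [s,t), ordered by the restriction of O: the 1-based position of v in H
-- is pos O v - s + 1.
ΔBlock : ∀ {n} → Graph n → Permutation′ n → ℕ → ℕ → Fin n → ℤ
ΔBlock G O s t v = δind G (segment O s t) (suc (pos O v ∸ s))

-- An isoperimetric partition of (G, O): k blocks with boundaries
-- a : Fin (suc k) → ℕ (0-based), a 0 = 0, a k = n, strictly increasing;
-- block i (i < k) consists of the vertices with 0-based position in
-- [a i, a (i+1)), i.e. O[a_i, b_i] in 1-based notation with
-- a_i = a i + 1, b_i = a (i+1).
record IsoPartition {n} (G : Graph n) (O : Permutation′ n) : Set where
  field
    k        : ℕ
    bd       : Fin (suc k) → ℕ
    bd-first : bd Fin.zero ≡ 0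
    bd-last  : bd (fromℕ k) ≡ n
    bd-inc   : ∀ (i : Fin k) → bd (inject₁ i) < bd (Fin.suc i)
    block-opt : ∀ (i : Fin k) →
      OptimalOnBlock G O (bd (inject₁ i)) (bd (Fin.suc i))
    block-nbr : ∀ (i : Fin k) (v : Fin n) →
      bd (inject₁ i) ≤ pos O v → pos O v < bd (Fin.suc i) →
      + edgesBetween G (segment O 0 (bd (inject₁ i))) ⁅ v ⁆
        ≡ δ G (suc (bd (inject₁ i)))

-- In an optimal order, I(p+1) - I(p) is the number of edges added by the vertex in position
-- p+1, i.e. its neighbours among the vertices before it. Applied to G and to the block
-- H_i = O[a_i, b_i] with the restricted order, this splits the earlier neighbours of x in G
-- into those before the block, of which there are δ_G(a_i) by the partition condition, and
-- those inside it, counted by Δ_{H_i}(x). So Δ_G(x) = δ_G(a_i) + Δ_{H_i}(x) (also for the first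
-- vertex of the block, where δ(1) = 0), and the constant cancels in the difference.

module Submission where

open import Algebra.Properties.CommutativeSemigroup using (interchange)
open import Data.Bool using (Bool; true; false; _∧_; _∨_; T)
open import Data.Bool.Properties using (T-≡; T-∧; T-∨; ∧-comm; ∨-idem)
open import Data.Bool.Solver using (module ∨-∧-Solver)
open import Data.Empty using (⊥; ⊥-elim)
open import Data.Fin as Fin using (Fin; inject₁; suc; toℕ)
open import Data.Fin.Permutation using (Permutation′; _⟨$⟩ʳ_; _⟨$⟩ˡ_; inverseˡ)
open import Data.Fin.Properties using (toℕ-injective; toℕ<n)
open import Data.Fin.Subset using (Subset; _∪_; ⊤; _∈_)
open import Data.Fin.Subset.Properties using (⊆-antisym; x∈p∪q⁺; x∈p∪q⁻; ∈⊤)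
import Data.Integer as ℤ
open import Data.Integer using (_-_)
open import Data.Integer.Properties using (pos-+; [+m]-[+n]≡m⊖n; ⊖-≥)
  renaming (+-identityʳ to ℤ+-identityʳ)
open import Data.Integer.Tactic.RingSolver using (solve-∀)
open import Data.List using (List; []; _∷_; map; allFin)
open import Data.List.Properties using (map-cong)
open import Data.Nat using (ℕ; suc; _+_; _∸_; _≤_; _<_; _<ᵇ_; _≤ᵇ_; _≡ᵇ_; _<?_; z≤n; s≤s⁻¹)
open import Data.Nat.ListAction using (sum)
open import Data.Nat.Properties
  using (+-commutativeSemigroup; +-identityʳ; +-comm; +-suc; ≤-refl; ≤-reflexive; ≤-trans;
         ≤-antisym; <-≤-trans; ≤-<-trans; <⇒≤; <⇒≱; ≮⇒≥; n≤1+n; n<1+n; m≤m+n; m+n∸m≡n;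
         m+[n∸m]≡n; m<n⇒0<n∸m; m+n≤o⇒m≤o∸n; m≤n⇒m<n∨m≡n; n∸n≡0;
         ≤ᵇ⇒≤; ≤⇒≤ᵇ; <ᵇ⇒<; <⇒<ᵇ; ≡ᵇ⇒≡; ≡⇒≡ᵇ)
open import Data.Product using (_×_; _,_; proj₁; proj₂)
open import Data.Sum using (_⊎_; inj₁; inj₂)
open import Data.Vec using ([]; _∷_; lookup)
open import Data.Vec.Properties using (lookup∘tabulate; lookup-zipWith; []=⇒lookup; lookup⇒[]=)
open import Function using (Equivalence)
open import Relation.Binary.PropositionalEquality
  using (_≡_; refl; sym; trans; cong; cong₂; subst; module ≡-Reasoning)
open import Relation.Nullary using (yes; no)

open import Defs

open Equivalence using (to; from)
open ≡-Reasoning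

𝟙 : Bool → ℕ
𝟙 true  = 1
𝟙 false = 0

Disjoint : ∀ {n} → Subset n → Subset n → Set
Disjoint A B = ∀ {u} → u ∈ A → u ∈ B → ⊥

∈⇒T-lookup : ∀ {n} {A : Subset n} {u} → u ∈ A → T (lookup A u)
∈⇒T-lookup u∈A = from T-≡ ([]=⇒lookup u∈A)

T-lookup⇒∈ : ∀ {n} (A : Subset n) u → T (lookup A u) → u ∈ A
T-lookup⇒∈ A u t = lookup⇒[]= u A (to T-≡ t)

∈-⁅⁆⁻ : ∀ {n} {u v : Fin n} → u ∈ ⁅ v ⁆ → u ≡ v
∈-⁅⁆⁻ {u = u} {v} u∈v = toℕ-injective (≡ᵇ⇒≡ _ _
  (subst T (lookup∘tabulate (λ x → toℕ x ≡ᵇ toℕ v) u) (∈⇒T-lookup u∈v)))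

∈-⁅⁆⁺ : ∀ {n} (v : Fin n) → v ∈ ⁅ v ⁆
∈-⁅⁆⁺ v = T-lookup⇒∈ ⁅ v ⁆ v
  (subst T (sym (lookup∘tabulate (λ x → toℕ x ≡ᵇ toℕ v) v)) (≡⇒≡ᵇ (toℕ v) (toℕ v) refl))

sum-map-+ : ∀ {A : Set} (f g : A → ℕ) (xs : List A) →
  sum (map (λ x → f x + g x) xs) ≡ sum (map f xs) + sum (map g xs)
sum-map-+ f g []       = refl
sum-map-+ f g (x ∷ xs) =
  trans (cong (λ s → f x + g x + s) (sum-map-+ f g xs)) (interchange +-commutativeSemigroup (f x) (g x) _ _)

sum-map-zero : ∀ {A : Set} {f : A → ℕ} → (∀ x → f x ≡ 0) → (xs : List A) → sum (map f xs) ≡ 0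
sum-map-zero f≡0 []       = refl
sum-map-zero f≡0 (x ∷ xs) = cong₂ _+_ (f≡0 x) (sum-map-zero f≡0 xs)

module _ {n : ℕ} where

  pairSum : (Fin n → Fin n → ℕ) → ℕ
  pairSum f = sum (map (λ u → sum (map (f u) (allFin n))) (allFin n))

  pairSum-cong : {f g : Fin n → Fin n → ℕ} → (∀ u w → f u w ≡ g u w) → pairSum f ≡ pairSum g
  pairSum-cong f≡g = cong sum (map-cong (λ u → cong sum (map-cong (f≡g u) (allFin n))) (allFin n))

  pairSum-+ : {f g h : Fin n → Fin n → ℕ} → (∀ u w → f u w ≡ g u w + h u w) →
    pairSum f ≡ pairSum g + pairSum h
  pairSum-+ {f} {g} {h} f≡g+h = begin
    pairSum f
      ≡⟨ cong sum (map-cong (λ u → trans (cong sum (map-cong (f≡g+h u) (allFin n)))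
                                         (sum-map-+ (g u) (h u) (allFin n))) (allFin n)) ⟩
    sum (map (λ u → sum (map (g u) (allFin n)) + sum (map (h u) (allFin n))) (allFin n))
      ≡⟨ sum-map-+ (λ u → sum (map (g u) (allFin n))) (λ u → sum (map (h u) (allFin n))) (allFin n) ⟩
    pairSum g + pairSum h ∎

  pairSum-zero : {f : Fin n → Fin n → ℕ} → (∀ u w → f u w ≡ 0) → pairSum f ≡ 0
  pairSum-zero f≡0 = sum-map-zero (λ u → sum-map-zero (f≡0 u) (allFin n)) (allFin n)

  joins : Subset n → Subset n → Fin n → Fin n → Bool
  joins A B u w = (lookup A u ∧ lookup B w) ∨ (lookup A w ∧ lookup B u)

  joins⁻ : ∀ A B u w → T (joins A B u w) → (u ∈ A × w ∈ B) ⊎ (w ∈ A × u ∈ B)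
  joins⁻ A B u w c with to T-∨ c
  ... | inj₁ uw = let u∈A , w∈B = to T-∧ uw in inj₁ (T-lookup⇒∈ A u u∈A , T-lookup⇒∈ B w w∈B)
  ... | inj₂ wu = let w∈A , u∈B = to T-∧ wu in inj₂ (T-lookup⇒∈ A w w∈A , T-lookup⇒∈ B u u∈B)

  joins-self⁻ : ∀ A u w → T (joins A A u w) → u ∈ A × w ∈ A
  joins-self⁻ A u w c with joins⁻ A A u w c
  ... | inj₁ (u∈A , w∈A) = u∈A , w∈A
  ... | inj₂ (w∈A , u∈A) = u∈A , w∈A

  joins-self : ∀ A u w → joins A A u w ≡ lookup A u ∧ lookup A w
  joins-self A u w =
    trans (cong ((lookup A u ∧ lookup A w) ∨_) (∧-comm (lookup A w) (lookup A u))) (∨-idem _)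

  joins-∪ˡ : ∀ A B C u w → joins (A ∪ B) C u w ≡ joins A C u w ∨ joins B C u w
  joins-∪ˡ A B C u w = begin
    joins (A ∪ B) C u w
      ≡⟨ cong₂ (λ x y → (x ∧ lookup C w) ∨ (y ∧ lookup C u))
               (lookup-zipWith _∨_ u A B) (lookup-zipWith _∨_ w A B) ⟩
    ((lookup A u ∨ lookup B u) ∧ lookup C w) ∨ ((lookup A w ∨ lookup B w) ∧ lookup C u)
      ≡⟨ solve 6 (λ au bu cu aw bw cw →
           ((au :+ bu) :* cw) :+ ((aw :+ bw) :* cu)
             := ((au :* cw) :+ (aw :* cu)) :+ ((bu :* cw) :+ (bw :* cu))) refl
           (lookup A u) (lookup B u) (lookup C u) (lookup A w) (lookup B w) (lookup C w) ⟩
    joins A C u w ∨ joins B C u w ∎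
    where open ∨-∧-Solver

  joins-∪-self : ∀ A B u w → joins (A ∪ B) (A ∪ B) u w ≡ joins A A u w ∨ (joins A B u w ∨ joins B B u w)
  joins-∪-self A B u w = begin
    joins (A ∪ B) (A ∪ B) u w
      ≡⟨ joins-self (A ∪ B) u w ⟩
    lookup (A ∪ B) u ∧ lookup (A ∪ B) w
      ≡⟨ cong₂ _∧_ (lookup-zipWith _∨_ u A B) (lookup-zipWith _∨_ w A B) ⟩
    (lookup A u ∨ lookup B u) ∧ (lookup A w ∨ lookup B w)
      ≡⟨ solve 4 (λ au bu aw bw →
           (au :+ bu) :* (aw :+ bw) := (au :* aw) :+ (((au :* bw) :+ (aw :* bu)) :+ (bu :* bw))) refl
           (lookup A u) (lookup B u) (lookup A w) (lookup B w) ⟩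
    (lookup A u ∧ lookup A w) ∨ (joins A B u w ∨ (lookup B u ∧ lookup B w))
      ≡⟨ cong₂ (λ x y → x ∨ (joins A B u w ∨ y)) (joins-self A u w) (joins-self B u w) ⟨
    joins A A u w ∨ (joins A B u w ∨ joins B B u w) ∎
    where open ∨-∧-Solver

𝟙-guard-∨ : ∀ a l x y → (T x → T y → ⊥) → 𝟙 (a ∧ l ∧ (x ∨ y)) ≡ 𝟙 (a ∧ l ∧ x) + 𝟙 (a ∧ l ∧ y)
𝟙-guard-∨ false _     _     _     _  = refl
𝟙-guard-∨ true  false _     _     _  = refl
𝟙-guard-∨ true  true  true  true  xy = ⊥-elim (xy _ _)
𝟙-guard-∨ true  true  true  false _  = refl
𝟙-guard-∨ true  true  false _     _  = refl

𝟙-guard-none : ∀ a l x → (T a → T x → ⊥) → 𝟙 (a ∧ l ∧ x) ≡ 0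
𝟙-guard-none false _     _     _  = refl
𝟙-guard-none true  false _     _  = refl
𝟙-guard-none true  true  false _  = refl
𝟙-guard-none true  true  true  ax = ⊥-elim (ax _ _)

-- The 0/1 indicator summed by edgesBetween is private to Defs. On K₂ with these two sets
-- edgesBetween reduces to that indicator applied to b (plus two zeros), which lets us
-- replace it by 𝟙.
private
  K₂-adj : Fin 2 → Fin 2 → Bool
  K₂-adj Fin.zero       (Fin.suc Fin.zero) = true
  K₂-adj (Fin.suc Fin.zero) Fin.zero       = true
  K₂-adj _              _                  = false

  K₂ : Graph 2
  K₂ = record { adj = K₂-adj ; adj-sym = sym′ ; adj-irr = irr }
    where
    sym′ : ∀ u v → K₂-adj u v ≡ K₂-adj v u
    sym′ Fin.zero           Fin.zero           = refl
    sym′ Fin.zero           (Fin.suc Fin.zero) = refl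
    sym′ (Fin.suc Fin.zero) Fin.zero           = refl
    sym′ (Fin.suc Fin.zero) (Fin.suc Fin.zero) = refl
    irr : ∀ v → K₂-adj v v ≡ false
    irr Fin.zero           = refl
    irr (Fin.suc Fin.zero) = refl

  indicator≡𝟙 : ∀ b → edgesBetween K₂ (false ∷ true ∷ []) (b ∷ true ∷ []) ≡ 𝟙 b
  indicator≡𝟙 true  = refl
  indicator≡𝟙 false = refl

  x+0+0≡x : ∀ x → x + 0 + 0 ≡ x
  x+0+0≡x x = trans (+-identityʳ (x + 0)) (+-identityʳ x)

module _ {n} (G : Graph n) where

  edgeCount : (Fin n → Fin n → Bool) → ℕ
  edgeCount p = pairSum (λ u w → 𝟙 (adj G u w ∧ (toℕ u <ᵇ toℕ w) ∧ p u w))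

  edgesBetween-edgeCount : ∀ A B → edgesBetween G A B ≡ edgeCount (joins A B)
  edgesBetween-edgeCount A B =
    pairSum-cong (λ u w → trans (sym (x+0+0≡x _)) (indicator≡𝟙 (adj G u w ∧ (toℕ u <ᵇ toℕ w) ∧ joins A B u w)))

  edgeCount-cong : ∀ {p q} → (∀ u w → p u w ≡ q u w) → edgeCount p ≡ edgeCount q
  edgeCount-cong p≡q = pairSum-cong (λ u w → cong (λ b → 𝟙 (adj G u w ∧ (toℕ u <ᵇ toℕ w) ∧ b)) (p≡q u w))

  edgeCount-∨ : ∀ {p q} → (∀ u w → T (p u w) → T (q u w) → ⊥) →
    edgeCount (λ u w → p u w ∨ q u w) ≡ edgeCount p + edgeCount q
  edgeCount-∨ exclusive = pairSum-+ (λ u w → 𝟙-guard-∨ (adj G u w) (toℕ u <ᵇ toℕ w) _ _ (exclusive u w))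

  edgeCount-none : ∀ {p} → (∀ u w → T (adj G u w) → T (p u w) → ⊥) → edgeCount p ≡ 0
  edgeCount-none no-edge = pairSum-zero (λ u w → 𝟙-guard-none (adj G u w) (toℕ u <ᵇ toℕ w) _ (no-edge u w))

  edgesBetween-∪ˡ : ∀ {A B C} → Disjoint A B → Disjoint A C →
    edgesBetween G (A ∪ B) C ≡ edgesBetween G A C + edgesBetween G B C
  edgesBetween-∪ˡ {A} {B} {C} A∩B A∩C = begin
    edgesBetween G (A ∪ B) C                         ≡⟨ edgesBetween-edgeCount (A ∪ B) C ⟩
    edgeCount (joins (A ∪ B) C)                        ≡⟨ edgeCount-cong (joins-∪ˡ A B C) ⟩
    edgeCount (λ u w → joins A C u w ∨ joins B C u w)    ≡⟨ edgeCount-∨ exclusive ⟩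
    edgeCount (joins A C) + edgeCount (joins B C)        ≡⟨ cong₂ _+_ (edgesBetween-edgeCount A C)
                                                                   (edgesBetween-edgeCount B C) ⟨
    edgesBetween G A C + edgesBetween G B C          ∎
    where
    exclusive : ∀ u w → T (joins A C u w) → T (joins B C u w) → ⊥
    exclusive u w ac bc with joins⁻ A C u w ac | joins⁻ B C u w bc
    ... | inj₁ (u∈A , _)   | inj₁ (u∈B , _)   = A∩B u∈A u∈B
    ... | inj₁ (u∈A , _)   | inj₂ (_ , u∈C)   = A∩C u∈A u∈C
    ... | inj₂ (w∈A , _)   | inj₁ (_ , w∈C)   = A∩C w∈A w∈C
    ... | inj₂ (w∈A , _)   | inj₂ (w∈B , _)   = A∩B w∈A w∈B

  edgesIn-∪ : ∀ {A B} → Disjoint A B →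
    edgesIn G (A ∪ B) ≡ edgesIn G A + (edgesBetween G A B + edgesIn G B)
  edgesIn-∪ {A} {B} A∩B = begin
    edgesIn G (A ∪ B)
      ≡⟨ edgesBetween-edgeCount (A ∪ B) (A ∪ B) ⟩
    edgeCount (joins (A ∪ B) (A ∪ B))
      ≡⟨ edgeCount-cong (joins-∪-self A B) ⟩
    edgeCount (λ u w → joins A A u w ∨ (joins A B u w ∨ joins B B u w))
      ≡⟨ edgeCount-∨ inside-A-excludes-rest ⟩
    edgeCount (joins A A) + edgeCount (λ u w → joins A B u w ∨ joins B B u w)
      ≡⟨ cong (edgeCount (joins A A) +_) (edgeCount-∨ across-excludes-inside-B) ⟩
    edgeCount (joins A A) + (edgeCount (joins A B) + edgeCount (joins B B))
      ≡⟨ cong₂ (λ x y → x + (y + edgeCount (joins B B))) (edgesBetween-edgeCount A A)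
                                                      (edgesBetween-edgeCount A B) ⟨
    edgesIn G A + (edgesBetween G A B + edgeCount (joins B B))
      ≡⟨ cong (λ z → edgesIn G A + (edgesBetween G A B + z)) (edgesBetween-edgeCount B B) ⟨
    edgesIn G A + (edgesBetween G A B + edgesIn G B) ∎
    where
    across-excludes-inside-B : ∀ u w → T (joins A B u w) → T (joins B B u w) → ⊥
    across-excludes-inside-B u w ab bb with joins⁻ A B u w ab | joins-self⁻ B u w bb
    ... | inj₁ (u∈A , _) | u∈B , _ = A∩B u∈A u∈B
    ... | inj₂ (w∈A , _) | _ , w∈B = A∩B w∈A w∈B

    inside-A-excludes-rest : ∀ u w → T (joins A A u w) → T (joins A B u w ∨ joins B B u w) → ⊥
    inside-A-excludes-rest u w aa rest with joins-self⁻ A u w aa | to T-∨ rest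
    ... | u∈A , _   | inj₂ bb = A∩B u∈A (proj₁ (joins-self⁻ B u w bb))
    ... | u∈A , w∈A | inj₁ ab with joins⁻ A B u w ab
    ...   | inj₁ (_ , w∈B) = A∩B w∈A w∈B
    ...   | inj₂ (_ , u∈B) = A∩B u∈A u∈B

  edgesIn-⁅⁆ : ∀ v → edgesIn G ⁅ v ⁆ ≡ 0
  edgesIn-⁅⁆ v = trans (edgesBetween-edgeCount ⁅ v ⁆ ⁅ v ⁆) (edgeCount-none loopless)
    where
    loopless : ∀ u w → T (adj G u w) → T (joins ⁅ v ⁆ ⁅ v ⁆ u w) → ⊥
    loopless u w uw vv with joins-self⁻ ⁅ v ⁆ u w vv
    ... | u∈v , w∈v with ∈-⁅⁆⁻ u∈v | ∈-⁅⁆⁻ w∈v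
    ... | refl | refl = subst T (adj-irr G u) uw

module _ {n} (O : Permutation′ n) where

  pos-injective : ∀ {u v} → pos O u ≡ pos O v → u ≡ v
  pos-injective {u} {v} eq = begin
    u                 ≡⟨ inverseˡ O ⟨
    O ⟨$⟩ˡ (O ⟨$⟩ʳ u) ≡⟨ cong (O ⟨$⟩ˡ_) (toℕ-injective eq) ⟩
    O ⟨$⟩ˡ (O ⟨$⟩ʳ v) ≡⟨ inverseˡ O ⟩
    v                 ∎

  segment⁻ : ∀ a b {u} → u ∈ segment O a b → a ≤ pos O u × pos O u < b
  segment⁻ a b {u} u∈ab
    with to T-∧ (subst T (lookup∘tabulate (λ v → (a ≤ᵇ pos O v) ∧ (pos O v <ᵇ b)) u) (∈⇒T-lookup u∈ab))
  ... | a≤p , p<b = ≤ᵇ⇒≤ a (pos O u) a≤p , <ᵇ⇒< (pos O u) b p<b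

  segment⁺ : ∀ a b {u} → a ≤ pos O u → pos O u < b → u ∈ segment O a b
  segment⁺ a b {u} a≤p p<b = T-lookup⇒∈ (segment O a b) u
    (subst T (sym (lookup∘tabulate (λ v → (a ≤ᵇ pos O v) ∧ (pos O v <ᵇ b)) u))
             (from T-∧ (≤⇒≤ᵇ a≤p , <⇒<ᵇ p<b)))

  segment-disjoint : ∀ {a b c d} → b ≤ c → Disjoint (segment O a b) (segment O c d)
  segment-disjoint {a} {b} {c} {d} b≤c u∈ab u∈cd =
    <⇒≱ (proj₂ (segment⁻ a b u∈ab)) (≤-trans b≤c (proj₁ (segment⁻ c d u∈cd)))

  segment-split : ∀ {a b c} → a ≤ b → b ≤ c → segment O a c ≡ segment O a b ∪ segment O b c
  segment-split {a} {b} {c} a≤b b≤c = ⊆-antisym split join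
    where
    split : ∀ {u} → u ∈ segment O a c → u ∈ segment O a b ∪ segment O b c
    split {u} u∈ac with segment⁻ a c u∈ac | pos O u <? b
    ... | a≤p , _   | yes p<b = x∈p∪q⁺ (inj₁ (segment⁺ a b a≤p p<b))
    ... | _   , p<c | no  p≮b = x∈p∪q⁺ (inj₂ (segment⁺ b c (≮⇒≥ p≮b) p<c))

    join : ∀ {u} → u ∈ segment O a b ∪ segment O b c → u ∈ segment O a c
    join u∈ with x∈p∪q⁻ (segment O a b) (segment O b c) u∈
    ... | inj₁ u∈ab = let a≤p , p<b = segment⁻ a b u∈ab in segment⁺ a c a≤p (<-≤-trans p<b b≤c)
    ... | inj₂ u∈bc = let b≤p , p<c = segment⁻ b c u∈bc in segment⁺ a c (≤-trans a≤b b≤p) p<c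

  segment-singleton : ∀ v → segment O (pos O v) (suc (pos O v)) ≡ ⁅ v ⁆
  segment-singleton v = ⊆-antisym only-v has-v
    where
    only-v : ∀ {u} → u ∈ segment O (pos O v) (suc (pos O v)) → u ∈ ⁅ v ⁆
    only-v u∈ with segment⁻ (pos O v) (suc (pos O v)) u∈
    ... | p≤q , q<1+p with pos-injective (≤-antisym (s≤s⁻¹ q<1+p) p≤q)
    ...   | refl = ∈-⁅⁆⁺ v

    has-v : ∀ {u} → u ∈ ⁅ v ⁆ → u ∈ segment O (pos O v) (suc (pos O v))
    has-v u∈v with ∈-⁅⁆⁻ u∈v
    ... | refl = segment⁺ (pos O v) (suc (pos O v)) ≤-refl (n<1+n (pos O v))

  segment-full : segment O 0 n ≡ ⊤
  segment-full = ⊆-antisym (λ _ → ∈⊤) (λ {u} _ → segment⁺ 0 n z≤n (toℕ<n (O ⟨$⟩ʳ u)))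

[+m+n]-[+m]≡+n : ∀ m k → ℤ.+ (m + k) - ℤ.+ m ≡ ℤ.+ k
[+m+n]-[+m]≡+n m k =
  trans ([+m]-[+n]≡m⊖n (m + k) m) (trans (⊖-≥ (m≤m+n m k)) (cong ℤ.+_ (m+n∸m≡n m k)))

[k+m]-[k+n]≡m-n : ∀ k m n → (k ℤ.+ m) - (k ℤ.+ n) ≡ m - n
[k+m]-[k+n]≡m-n = solve-∀

module _ {n} (G : Graph n) (O : Permutation′ n) where

  edgesIn-segment-suc : ∀ {a} v → a ≤ pos O v →
    edgesIn G (segment O a (suc (pos O v)))
      ≡ edgesIn G (segment O a (pos O v)) + edgesBetween G (segment O a (pos O v)) ⁅ v ⁆
  edgesIn-segment-suc {a} v a≤p = begin
    edgesIn G (segment O a (suc p))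
      ≡⟨ cong (edgesIn G) (segment-split O a≤p (n≤1+n p)) ⟩
    edgesIn G (A ∪ segment O p (suc p))
      ≡⟨ edgesIn-∪ G (segment-disjoint O {a} {p} {p} {suc p} ≤-refl) ⟩
    edgesIn G A + (edgesBetween G A (segment O p (suc p)) + edgesIn G (segment O p (suc p)))
      ≡⟨ cong (λ S → edgesIn G A + (edgesBetween G A S + edgesIn G S)) (segment-singleton O v) ⟩
    edgesIn G A + (edgesBetween G A ⁅ v ⁆ + edgesIn G ⁅ v ⁆)
      ≡⟨ cong (λ k → edgesIn G A + (edgesBetween G A ⁅ v ⁆ + k)) (edgesIn-⁅⁆ G v) ⟩
    edgesIn G A + (edgesBetween G A ⁅ v ⁆ + 0)
      ≡⟨ cong (λ k → edgesIn G A + k) (+-identityʳ _) ⟩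
    edgesIn G A + edgesBetween G A ⁅ v ⁆ ∎
    where
    p = pos O v
    A = segment O a p

  edgesBetween-segment-split : ∀ {a b} v → a ≤ b → b ≤ pos O v →
    edgesBetween G (segment O a (pos O v)) ⁅ v ⁆
      ≡ edgesBetween G (segment O a b) ⁅ v ⁆ + edgesBetween G (segment O b (pos O v)) ⁅ v ⁆
  edgesBetween-segment-split {a} {b} v a≤b b≤p = begin
    edgesBetween G (segment O a (pos O v)) ⁅ v ⁆
      ≡⟨ cong (λ S → edgesBetween G S ⁅ v ⁆) (segment-split O a≤b b≤p) ⟩
    edgesBetween G (segment O a b ∪ segment O b (pos O v)) ⁅ v ⁆
      ≡⟨ edgesBetween-∪ˡ G (segment-disjoint O {a} {b} {b} {pos O v} ≤-refl)
           (subst (Disjoint (segment O a b)) (segment-singleton O v)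
                  (segment-disjoint O {a} {b} {pos O v} {suc (pos O v)} b≤p)) ⟩
    edgesBetween G (segment O a b) ⁅ v ⁆ + edgesBetween G (segment O b (pos O v)) ⁅ v ⁆ ∎

  δind-neighbours : ∀ {s t} v → OptimalOnBlock G O s t → s < pos O v → pos O v < t →
    δind G (segment O s t) (suc (pos O v ∸ s)) ≡ ℤ.+ edgesBetween G (segment O s (pos O v)) ⁅ v ⁆
  δind-neighbours {s} {t} v optimal s<p p<t
    with pos O v ∸ s | m+[n∸m]≡n (<⇒≤ s<p) | m<n⇒0<n∸m s<p
  ... | suc j | s+[j+1]≡p | _ = begin
    ℤ.+ Iind G W (suc (suc j)) - ℤ.+ Iind G W (suc j)
      ≡⟨ cong₂ (λ x y → ℤ.+ x - ℤ.+ y) (optimal (suc (suc j)) j+2≤t-s)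
                                       (optimal (suc j) (≤-trans (n≤1+n _) j+2≤t-s)) ⟨
    ℤ.+ edgesIn G (segment O s (s + suc (suc j))) - ℤ.+ edgesIn G (segment O s (s + suc j))
      ≡⟨ cong₂ (λ x y → ℤ.+ edgesIn G (segment O s x) - ℤ.+ edgesIn G (segment O s y))
               s+[j+2]≡p+1 s+[j+1]≡p ⟩
    ℤ.+ edgesIn G (segment O s (suc p)) - ℤ.+ edgesIn G (segment O s p)
      ≡⟨ cong (λ x → ℤ.+ x - ℤ.+ edgesIn G (segment O s p)) (edgesIn-segment-suc v (<⇒≤ s<p)) ⟩
    ℤ.+ (edgesIn G (segment O s p) + edgesBetween G (segment O s p) ⁅ v ⁆)
      - ℤ.+ edgesIn G (segment O s p)
      ≡⟨ [+m+n]-[+m]≡+n (edgesIn G (segment O s p)) _ ⟩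
    ℤ.+ edgesBetween G (segment O s p) ⁅ v ⁆ ∎
    where
    p = pos O v
    W = segment O s t
    s+[j+2]≡p+1 : s + suc (suc j) ≡ suc p
    s+[j+2]≡p+1 = trans (+-suc s (suc j)) (cong suc s+[j+1]≡p)
    j+2≤t-s : suc (suc j) ≤ t ∸ s
    j+2≤t-s = m+n≤o⇒m≤o∸n (suc (suc j))
      (≤-trans (≤-reflexive (trans (+-comm (suc (suc j)) s) s+[j+2]≡p+1)) p<t)

  optimal⇒optimalOnBlock : Optimal G O → OptimalOnBlock G O 0 n
  optimal⇒optimalOnBlock optimal j j≤n =
    subst (λ W → edgesIn G (segment O 0 j) ≡ Iind G W j) (sym (segment-full O)) (optimal j j≤n)

  Δ-neighbours : Optimal G O → ∀ v → 0 < pos O v →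
    Δ G O v ≡ ℤ.+ edgesBetween G (segment O 0 (pos O v)) ⁅ v ⁆
  Δ-neighbours optimal v 0<p =
    trans (cong (λ W → δind G W (suc (pos O v))) (sym (segment-full O)))
          (δind-neighbours v (optimal⇒optimalOnBlock optimal) 0<p (toℕ<n (O ⟨$⟩ʳ v)))

  Δ≡δ+ΔBlock : ∀ {s t} v → Optimal G O → OptimalOnBlock G O s t →
    ℤ.+ edgesBetween G (segment O 0 s) ⁅ v ⁆ ≡ δ G (suc s) →
    s ≤ pos O v → pos O v < t →
    Δ G O v ≡ δ G (suc s) ℤ.+ ΔBlock G O s t v
  Δ≡δ+ΔBlock {s} {t} v optimal block-optimal earlier s≤p p<t with m≤n⇒m<n∨m≡n s≤p
  ... | inj₂ refl = sym (trans (cong (λ k → δ G (suc s) ℤ.+ δind G (segment O s t) (suc k)) (n∸n≡0 s))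
                               (ℤ+-identityʳ (δ G (suc s))))
  ... | inj₁ s<p = begin
    Δ G O v
      ≡⟨ Δ-neighbours optimal v (≤-<-trans z≤n s<p) ⟩
    ℤ.+ edgesBetween G (segment O 0 (pos O v)) ⁅ v ⁆
      ≡⟨ cong ℤ.+_ (edgesBetween-segment-split v z≤n (<⇒≤ s<p)) ⟩
    ℤ.+ (edgesBetween G (segment O 0 s) ⁅ v ⁆ + edgesBetween G (segment O s (pos O v)) ⁅ v ⁆)
      ≡⟨ pos-+ (edgesBetween G (segment O 0 s) ⁅ v ⁆) _ ⟩
    ℤ.+ edgesBetween G (segment O 0 s) ⁅ v ⁆ ℤ.+ ℤ.+ edgesBetween G (segment O s (pos O v)) ⁅ v ⁆
      ≡⟨ cong₂ ℤ._+_ earlier (sym (δind-neighbours v block-optimal s<p p<t)) ⟩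
    δ G (suc s) ℤ.+ ΔBlock G O s t v ∎

lemma3 : ∀ {n} (G : Graph n) (O : Permutation′ n) → Optimal G O →
    (P : IsoPartition G O) →
    let open IsoPartition P in
    ∀ (i : Fin k) (x y : Fin n) →
    bd (inject₁ i) ≤ pos O x → pos O x < bd (suc i) →
    bd (inject₁ i) ≤ pos O y → pos O y < bd (suc i) →
    pos O y < pos O x →
    Δ G O x - Δ G O y
      ≡ ΔBlock G O (bd (inject₁ i)) (bd (suc i)) x
        - ΔBlock G O (bd (inject₁ i)) (bd (suc i)) y
lemma3 G O optimal P i x y s≤x x<t s≤y y<t _ = begin
  Δ G O x - Δ G O y
    ≡⟨ cong₂ _-_ (decompose x s≤x x<t) (decompose y s≤y y<t) ⟩
  (δ G (suc s) ℤ.+ ΔBlock G O s t x) - (δ G (suc s) ℤ.+ ΔBlock G O s t y)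
    ≡⟨ [k+m]-[k+n]≡m-n (δ G (suc s)) _ _ ⟩
  ΔBlock G O s t x - ΔBlock G O s t y ∎
  where
  open IsoPartition P
  s = bd (inject₁ i)
  t = bd (suc i)
  decompose : ∀ v → s ≤ pos O v → pos O v < t → Δ G O v ≡ δ G (suc s) ℤ.+ ΔBlock G O s t v
  decompose v s≤v v<t = Δ≡δ+ΔBlock G O v optimal (block-opt i) (block-nbr i v s≤v v<t) s≤v v<t
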